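{- For every integer $q\ge 2$, the set $\mathcal{C}_{2q+1}(D_q)$ of all $(2q+1)$-colourings of $D_q$ does not form a Kempe class.
   Context: For an integer $q\ge2$, let $\overline{D_q}$ be the graph on the $4q+2$ vertices $u_0,u_1,\dots,u_{q+1}$ and $v_{i1},v_{i2},v_{i3}$ ($i=1,\dots,q$) whose edges are: the edges of the Hamiltonian cycle $u_0,u_1,\dots,u_{q+1},v_{11},v_{12},v_{13},v_{21},v_{22},v_{23},\dots,v_{q1},v_{q2},v_{q3},u_0$; the edges $u_iv_{i2}$ for $i=1,\dots,q$; and the edges $v_{i1}v_{i3}$ for $i=1,\dots,q$. Let $D_q$ be the complement of $\overline{D_q}$. A $k$-colouring is a proper colouring with colours $1,\dots,k$; $\mathcal{C}_k(G)$ is the set of all $k$-colourings of $G$. A Kempe chain (for a colouring and two colours $a,b$) is a connected component of the subgraph induced by the vertices coloured $a$ or $b$; a Kempe swap interchanges $a$ and $b$ on one Kempe chain. Two colourings are Kempe equivalent if each can be obtained from the other by a sequence of Kempe swaps; a set of colourings forms a Kempe class if its members are pairwise Kempe equivalent. -}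

module Defs where

open import Data.Nat using (ℕ; zero; suc; _+_; _*_; _∸_; _≤_; _<_)
open import Data.Fin using (Fin; toℕ; _≟_)
open import Data.Product using (_×_; Σ)
open import Data.Sum using (_⊎_)
open import Relation.Nullary using (¬_; yes; no)
open import Relation.Binary.PropositionalEquality using (_≡_; _≢_)
open import Relation.Binary.Construct.Closure.ReflexiveTransitive using (Star)

Graph : ℕ → Set₁
Graph n = Fin n → Fin n → Set

-- The graph \overline{D_q}, on 4q+2 vertices numbered 0 .. 4q+1:
--   u_i      ↦ i                       (i = 0 .. q+1)
--   v_{ij}   ↦ q + 2 + 3(i-1) + (j-1)  (i = 1 .. q, j = 1,2,3)
-- so v_{i1} = q+3i-1, v_{i2} = q+3i, v_{i3} = q+3i+1, and the Hamiltonian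
-- cycle u_0,...,u_{q+1},v_{11},...,v_{q3},u_0 visits 0,1,...,4q+1,0.

data Arc (q : ℕ) : ℕ → ℕ → Set where
  -- consecutive vertices of the Hamiltonian cycle
  cyc       : ∀ {x} → suc x < 4 * q + 2 → Arc q x (suc x)
  -- closing edge v_{q3} u_0
  cyc-close : Arc q (4 * q + 1) 0
  -- u_i v_{i2}
  spoke     : ∀ {i} → 1 ≤ i → i ≤ q → Arc q i (q + 3 * i)
  -- v_{i1} v_{i3}
  chord     : ∀ {i} → 1 ≤ i → i ≤ q → Arc q (q + 3 * i ∸ 1) (q + 3 * i + 1)

DqBar : (q : ℕ) → Graph (4 * q + 2)
DqBar q x y = Arc q (toℕ x) (toℕ y) ⊎ Arc q (toℕ y) (toℕ x)

Dq : (q : ℕ) → Graph (4 * q + 2)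
Dq q x y = x ≢ y × ¬ DqBar q x y

Assignment : ℕ → ℕ → Set
Assignment n k = Fin n → Fin k

IsColouring : ∀ {n} (G : Graph n) (k : ℕ) → Assignment n k → Set
IsColouring G k c = ∀ x y → G x y → c x ≢ c y

InAB : ∀ {n k} → Assignment n k → Fin k → Fin k → Fin n → Set
InAB c a b x = c x ≡ a ⊎ c x ≡ b

data SameChain {n k} (G : Graph n) (c : Assignment n k) (a b : Fin k) (v : Fin n)
     : Fin n → Set where
  here : InAB c a b v → SameChain G c a b v v
  next : ∀ {y z} → SameChain G c a b v y → G y z → InAB c a b z →
         SameChain G c a b v z

swapCol : ∀ {k} → Fin k → Fin k → Fin k → Fin k
swapCol a b x with x ≟ a
... | yes _ = b
... | no _ with x ≟ b
...   | yes _ = a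
...   | no _ = x

KempeSwap : ∀ {n k} (G : Graph n) → Assignment n k → Assignment n k → Set
KempeSwap {n} {k} G c c' =
  Σ (Fin k) λ a → Σ (Fin k) λ b → Σ (Fin n) λ v →
    InAB c a b v ×
    (∀ x → (SameChain G c a b v x → c' x ≡ swapCol a b (c x)) ×
           (¬ SameChain G c a b v x → c' x ≡ c x))

KempeEquivalent : ∀ {n k} (G : Graph n) → Assignment n k → Assignment n k → Set
KempeEquivalent G = Star (KempeSwap G)

IsKempeClass : ∀ {n} (G : Graph n) (k : ℕ) → Set
IsKempeClass G k = ∀ c₁ c₂ → IsColouring G k c₁ → IsColouring G k c₂ →
                   KempeEquivalent G c₁ c₂

{-# OPTIONS --safe #-}
module Submission where

open import Defs
open import Data.Nat
open import Data.Nat.Properties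
open import Data.Nat.DivMod using (_%_; _divMod_; DivMod; [m+kn]%n≡m%n; m<n⇒m%n≡m; m<n*o⇒m/o<n)
open import Data.Nat.Tactic.RingSolver using (solve-∀)
open import Data.Fin using (Fin; zero; suc; toℕ; fromℕ<)
import Data.Fin as Fin
open import Data.Fin.Properties using (toℕ<n; toℕ-injective; toℕ-fromℕ<; any?)
open import Data.Fin.Permutation using (Permutation′; permutation; _⟨$⟩ʳ_; _⟨$⟩ˡ_; inverseˡ; inverseʳ; _∘ₚ_)
import Data.Fin.Permutation as Permutation
open import Data.Product using (Σ-syntax; _×_; _,_; proj₁; proj₂)
open import Data.Sum using (_⊎_; inj₁; inj₂; [_,_]′)
import Data.Sum as Sum
open import Function using (_∘_)
open import Relation.Nullary using (¬_; Dec; yes; no; contradiction)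
open import Relation.Nullary.Decidable using (recompute; decidable-stable; _×-dec_; _⊎-dec_)
open import Relation.Binary.PropositionalEquality
open import Relation.Binary.Construct.Closure.ReflexiveTransitive using (Star; ε; _◅_)

-- Colour D_q with 2q+1 colours by taking as colour classes the 2q+1 edges of a perfect
-- matching M of \overline{D_q}. Between two edges of M there is at most one edge of
-- \overline{D_q}, so any two colour classes induce a connected subgraph of D_q: every Kempe
-- chain consists of two whole colour classes, and a Kempe swap merely renames two colours.
-- Hence every colouring Kempe equivalent to this one has the same colour classes. But
-- colouring the Hamiltonian cycle 0, 1, ..., 4q+1 by x ↦ ⌊x/2⌋ is also proper with 2q+1
-- colours, and it puts u_0 and u_1, which lie in different edges of M, in one class.

-- Kempe swaps when any two colour classes are linked

module _ {k : ℕ} where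

  swapCol-first : ∀ (a b : Fin k) → swapCol a b a ≡ b
  swapCol-first a b with a Fin.≟ a
  ... | yes _   = refl
  ... | no a≢a = contradiction refl a≢a

  swapCol-second : ∀ (a b : Fin k) → swapCol a b b ≡ a
  swapCol-second a b with b Fin.≟ a
  ... | yes b≡a = b≡a
  ... | no _ with b Fin.≟ b
  ...   | yes _   = refl
  ...   | no b≢b = contradiction refl b≢b

  swapCol-fixes : ∀ {a b x : Fin k} → x ≢ a → x ≢ b → swapCol a b x ≡ x
  swapCol-fixes {a} {b} {x} x≢a x≢b with x Fin.≟ a
  ... | yes x≡a = contradiction x≡a x≢a
  ... | no _ with x Fin.≟ b
  ...   | yes x≡b = contradiction x≡b x≢b
  ...   | no _    = refl

  swapCol-involutive : ∀ (a b x : Fin k) → swapCol a b (swapCol a b x) ≡ x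
  swapCol-involutive a b x with x Fin.≟ a
  ... | yes refl = swapCol-second x b
  ... | no x≢a with x Fin.≟ b
  ...   | yes refl = swapCol-first a x
  ...   | no x≢b   = swapCol-fixes x≢a x≢b

  swapCol-moves : ∀ {a b x : Fin k} → swapCol a b x ≢ x → a ≢ b × (x ≡ a ⊎ x ≡ b)
  swapCol-moves {a} {b} {x} moved = by-cases (x Fin.≟ a) (x Fin.≟ b)
    where
    open ≡-Reasoning
    by-cases : Dec (x ≡ a) → Dec (x ≡ b) → a ≢ b × (x ≡ a ⊎ x ≡ b)
    by-cases (yes x≡a) _ = (λ a≡b → moved (begin
      swapCol a b x ≡⟨ cong (swapCol a b) x≡a ⟩
      swapCol a b a ≡⟨ swapCol-first a b ⟩
      b             ≡⟨ sym (trans x≡a a≡b) ⟩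
      x             ∎)) , inj₁ x≡a
    by-cases (no _) (yes x≡b) = (λ a≡b → moved (begin
      swapCol a b x ≡⟨ cong (swapCol a b) x≡b ⟩
      swapCol a b b ≡⟨ swapCol-second a b ⟩
      a             ≡⟨ sym (trans x≡b (sym a≡b)) ⟩
      x             ∎)) , inj₂ x≡b
    by-cases (no x≢a) (no x≢b) = contradiction (swapCol-fixes x≢a x≢b) moved

  transposition : Fin k → Fin k → Permutation′ k
  transposition a b =
    permutation (swapCol a b) (swapCol a b) (swapCol-involutive a b) (swapCol-involutive a b)

chain-mono : ∀ {n k} {G : Graph n} {c d : Assignment n k} {α β a b v x} →
             (∀ {y} → InAB c α β y → InAB d a b y) →
             SameChain G c α β v x → SameChain G d a b v x
chain-mono f (here v∈)            = here (f v∈)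
chain-mono f (next chain edge z∈) = next (chain-mono f chain) edge (f z∈)

Recolouring : ∀ {n k} → Assignment n k → Assignment n k → Set
Recolouring {k = k} c d = Σ[ σ ∈ Permutation′ k ] (∀ x → d x ≡ σ ⟨$⟩ʳ c x)

module _ {n k : ℕ} {c d : Assignment n k} where

  recolouring-preserves : Recolouring c d → ∀ {x y} → c x ≡ c y → d x ≡ d y
  recolouring-preserves (σ , d≡σc) {x} {y} e =
    trans (d≡σc x) (trans (cong (σ ⟨$⟩ʳ_) e) (sym (d≡σc y)))

  recolouring-reflects : Recolouring c d → ∀ {x y} → d x ≡ d y → c x ≡ c y
  recolouring-reflects (σ , d≡σc) {x} {y} e = begin
    c x                 ≡⟨ inverseˡ σ ⟨
    σ ⟨$⟩ˡ (σ ⟨$⟩ʳ c x) ≡⟨ cong (σ ⟨$⟩ˡ_) (trans (sym (d≡σc x)) (trans e (d≡σc y))) ⟩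
    σ ⟨$⟩ˡ (σ ⟨$⟩ʳ c y) ≡⟨ inverseˡ σ ⟩
    c y                 ∎
    where open ≡-Reasoning

-- classes-linked says that two colour classes {x, partner x} and {y, partner y} span a
-- K_{2,2} in G with at most one edge missing.
module PairColouring
  {n k : ℕ} (G : Graph n) (G-sym : ∀ {x y} → G x y → G y x)
  (c : Assignment n k) (c-surjective : ∀ α → Σ[ x ∈ Fin n ] c x ≡ α)
  (partner : Fin n → Fin n)
  (partner-colour : ∀ x → c (partner x) ≡ c x)
  (partner-involutive : ∀ x → partner (partner x) ≡ x)
  (colour-class : ∀ {x y} → c x ≡ c y → y ≡ x ⊎ y ≡ partner x)
  (classes-linked : ∀ {x y} → c x ≢ c y →
                    G x y ⊎ (G x (partner y) × G (partner x) y × G (partner x) (partner y)))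
  where

  classes-connected : ∀ {v w x} → c v ≢ c w → InAB c (c v) (c w) x →
                      SameChain G c (c v) (c w) v x
  classes-connected {v} {w} cv≢cw = [ in-class reach-v reach-v′ , in-class reach-w reach-w′ ]′
    where
    Reach = SameChain G c (c v) (c w) v

    in-class : ∀ {y x} → Reach y → Reach (partner y) → c x ≡ c y → Reach x
    in-class reach-y reach-y′ e with colour-class (sym e)
    ... | inj₁ refl = reach-y
    ... | inj₂ refl = reach-y′

    v′∈ : InAB c (c v) (c w) (partner v)
    v′∈ = inj₁ (partner-colour v)
    w∈ : InAB c (c v) (c w) w
    w∈ = inj₂ refl
    w′∈ : InAB c (c v) (c w) (partner w)
    w′∈ = inj₂ (partner-colour w)

    reach-v : Reach v
    reach-v = here (inj₁ refl)

    reach-w : Reach w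
    reach-w with classes-linked cv≢cw
    ... | inj₁ vw = next reach-v vw w∈
    ... | inj₂ (vw′ , v′w , v′w′) =
      next (next (next reach-v vw′ w′∈) (G-sym v′w′) v′∈) v′w w∈

    reach-w′ : Reach (partner w)
    reach-w′ with classes-linked {v} {partner w} (λ e → cv≢cw (trans e (partner-colour w)))
    ... | inj₁ vw′ = next reach-v vw′ w′∈
    ... | inj₂ (vw , v′w′ , v′w) =
      next (next (next reach-v (subst (G v) (partner-involutive w) vw) w∈)
                 (G-sym (subst (G (partner v)) (partner-involutive w) v′w)) v′∈)
           v′w′ w′∈

    reach-v′ : Reach (partner v)
    reach-v′ with classes-linked {partner v} {w} (cv≢cw ∘ trans (sym (partner-colour v)))
    ... | inj₁ v′w        = next reach-w (G-sym v′w) v′∈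
    ... | inj₂ (v′w′ , _) = next reach-w′ (G-sym v′w′) v′∈

  chain-covers-both-colours : ∀ {d : Assignment n k} {a b v x} → Recolouring c d → a ≢ b →
                              d v ≡ a → InAB d a b x → SameChain G d a b v x
  chain-covers-both-colours {d} {a} {b} {v} ρ@(σ , d≡σc) a≢b dv≡a x∈ab =
    chain-mono recoloured (classes-connected cv≢cw (Sum.map (reflect dv≡a) (reflect dw≡b) x∈ab))
    where
    w = proj₁ (c-surjective (σ ⟨$⟩ˡ b))

    dw≡b : d w ≡ b
    dw≡b = trans (d≡σc w) (trans (cong (σ ⟨$⟩ʳ_) (proj₂ (c-surjective _))) (inverseʳ σ))

    cv≢cw : c v ≢ c w
    cv≢cw e = a≢b (trans (sym dv≡a) (trans (recolouring-preserves ρ e) dw≡b))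

    reflect : ∀ {y z α} → d z ≡ α → d y ≡ α → c y ≡ c z
    reflect dz≡α dy≡α = recolouring-reflects ρ (trans dy≡α (sym dz≡α))

    recoloured : ∀ {y} → InAB c (c v) (c w) y → InAB d a b y
    recoloured = Sum.map (λ e → trans (recolouring-preserves ρ e) dv≡a)
                         (λ e → trans (recolouring-preserves ρ e) dw≡b)

  kempeSwap-recolouring : ∀ {d d′} → Recolouring c d → KempeSwap G d d′ → Recolouring c d′
  kempeSwap-recolouring {d} {d′} ρ@(σ , d≡σc) (a , b , v , v∈ab , swapped) =
    σ ∘ₚ transposition a b , λ x → trans (swapped-everywhere x) (cong (swapCol a b) (d≡σc x))
    where
    in-chain : ∀ {x} → a ≢ b → InAB d a b x → SameChain G d a b v x
    in-chain a≢b =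
      [ (λ dv≡a → chain-covers-both-colours ρ a≢b dv≡a)
      , (λ dv≡b → chain-mono Sum.swap ∘ chain-covers-both-colours ρ (a≢b ∘ sym) dv≡b ∘ Sum.swap)
      ]′ v∈ab

    -- Colour equality is decidable, so it suffices to refute d′ x ≢ swapCol a b (d x): such
    -- an x lies outside the chain, yet is coloured a or b with a ≢ b, so it lies inside.
    swapped-everywhere : ∀ x → d′ x ≡ swapCol a b (d x)
    swapped-everywhere x = decidable-stable (d′ x Fin.≟ swapCol a b (d x)) λ d′x≢ →
      let outside : ¬ SameChain G d a b v x
          outside = d′x≢ ∘ proj₁ (swapped x)
          (a≢b , x∈ab) = swapCol-moves λ e → d′x≢ (trans (proj₂ (swapped x) outside) (sym e))
      in outside (in-chain a≢b x∈ab)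

  kempeEquivalent⇒recolouring : ∀ {d} → KempeEquivalent G c d → Recolouring c d
  kempeEquivalent⇒recolouring = go (Permutation.id , λ _ → refl)
    where
    go : ∀ {d d′} → Recolouring c d → Star (KempeSwap G) d d′ → Recolouring c d′
    go ρ ε        = ρ
    go ρ (s ◅ ss) = go (kempeSwap-recolouring ρ s) ss

  ¬kempeClass : IsColouring G k c → ∀ {c′ x y} → IsColouring G k c′ →
                   c′ x ≡ c′ y → c x ≢ c y → ¬ IsKempeClass G k
  ¬kempeClass c-proper {c′} c′-proper c′x≡c′y cx≢cy kempe =
    cx≢cy (recolouring-reflects (kempeEquivalent⇒recolouring (kempe c c′ c-proper c′-proper)) c′x≡c′y)

≤-recompute : ∀ {m n} → .(m ≤ n) → m ≤ n
≤-recompute = recompute (_ ≤? _)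

m≤n⇒m≢1+n+o : ∀ {m n} o → m ≤ n → m ≢ suc n + o
m≤n⇒m≢1+n+o o m≤n refl = 1+n≰n (≤-trans (m≤m+n _ o) m≤n)

⌊m/2⌋≡⌊n/2⌋⇒m≡n⊎adjacent : ∀ m n → ⌊ m /2⌋ ≡ ⌊ n /2⌋ → m ≡ n ⊎ n ≡ suc m ⊎ m ≡ suc n
⌊m/2⌋≡⌊n/2⌋⇒m≡n⊎adjacent 0 0 _ = inj₁ refl
⌊m/2⌋≡⌊n/2⌋⇒m≡n⊎adjacent 0 1 _ = inj₂ (inj₁ refl)
⌊m/2⌋≡⌊n/2⌋⇒m≡n⊎adjacent 1 0 _ = inj₂ (inj₂ refl)
⌊m/2⌋≡⌊n/2⌋⇒m≡n⊎adjacent 1 1 _ = inj₁ refl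
⌊m/2⌋≡⌊n/2⌋⇒m≡n⊎adjacent (suc (suc m)) (suc (suc n)) e =
  Sum.map (cong (2 +_)) (Sum.map (cong (2 +_)) (cong (2 +_)))
          (⌊m/2⌋≡⌊n/2⌋⇒m≡n⊎adjacent m n (suc-injective e))

m<n+n⇒⌊m/2⌋<n : ∀ {m n} → m < n + n → ⌊ m /2⌋ < n
m<n+n⇒⌊m/2⌋<n {0}           {suc n} _ = z<s
m<n+n⇒⌊m/2⌋<n {1}           {suc n} _ = z<s
m<n+n⇒⌊m/2⌋<n {suc (suc m)} {suc n} (s≤s m<n+n) =
  s≤s (m<n+n⇒⌊m/2⌋<n (s≤s⁻¹ (subst (suc (suc m) ≤_) (+-suc n n) m<n+n)))

-- The graph \overline{D_q}

arc? : ∀ q m n → Dec (Arc q m n)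
arc? q m n
  with n ≟ suc m ×-dec n <? 4 * q + 2
     | m ≟ 4 * q + 1 ×-dec n ≟ 0
     | 1 ≤? m ×-dec m ≤? q ×-dec n ≟ q + 3 * m
     | any? {P = Chord} (λ i → 1 ≤? toℕ i ×-dec toℕ i ≤? q ×-dec
                                m ≟ q + 3 * toℕ i ∸ 1 ×-dec n ≟ q + 3 * toℕ i + 1)
  where
  Chord : Fin (suc q) → Set
  Chord i = 1 ≤ toℕ i × toℕ i ≤ q × m ≡ q + 3 * toℕ i ∸ 1 × n ≡ q + 3 * toℕ i + 1
... | yes (refl , n<) | _ | _ | _ = yes (cyc n<)
... | no _ | yes (refl , refl) | _ | _ = yes cyc-close
... | no _ | no _ | yes (1≤m , m≤q , refl) | _ = yes (spoke 1≤m m≤q)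
... | no _ | no _ | no _ | yes (_ , 1≤i , i≤q , refl , refl) = yes (chord 1≤i i≤q)
... | no ¬cyc | no ¬close | no ¬spoke | no ¬chord = no λ
  { (cyc n<)            → ¬cyc (refl , n<)
  ; cyc-close           → ¬close (refl , refl)
  ; (spoke 1≤i i≤q)     → ¬spoke (1≤i , i≤q , refl)
  ; (chord {i} 1≤i i≤q) → ¬chord (fromℕ< (s≤s i≤q) ,
      subst (λ k → 1 ≤ k × k ≤ q × q + 3 * i ∸ 1 ≡ q + 3 * k ∸ 1 × q + 3 * i + 1 ≡ q + 3 * k + 1)
            (sym (toℕ-fromℕ< (s≤s i≤q))) (1≤i , i≤q , refl , refl))
  }

pattern first  = zero
pattern second = suc zero
pattern third  = suc (suc zero)

module D (r : ℕ) where

  q : ℕ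
  q = suc (suc r)

  -- u j is u_j, and v i t is v_{i+1,t+1}; position is the numbering of the vertices in Defs.
  data Vertex : Set where
    u : (j : ℕ) → .(j ≤ suc q) → Vertex
    v : (i : ℕ) → .(i < q) → Fin 3 → Vertex

  position : Vertex → ℕ
  position (u j _)   = j
  position (v i _ t) = suc (suc q) + (toℕ t + i * 3)

  vertex-count : suc (suc q) + q * 3 ≡ 4 * q + 2
  vertex-count = identity q
    where
    identity : ∀ m → suc (suc m) + m * 3 ≡ 4 * m + 2
    identity = solve-∀

  offset-bound : ∀ {i} (t : Fin 3) → i < q → toℕ t + i * 3 < q * 3
  offset-bound {i} t i<q = ≤-trans (+-monoˡ-< (i * 3) (toℕ<n t)) (*-monoˡ-≤ 3 i<q)

  offset-remainder : ∀ {t t′ : Fin 3} {i i′} → toℕ t + i * 3 ≡ toℕ t′ + i′ * 3 → t ≡ t′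
  offset-remainder {t} {t′} {i} {i′} e = toℕ-injective (begin
    toℕ t                  ≡⟨ m<n⇒m%n≡m (toℕ<n t) ⟨
    toℕ t % 3              ≡⟨ [m+kn]%n≡m%n (toℕ t) i 3 ⟨
    (toℕ t + i * 3) % 3    ≡⟨ cong (_% 3) e ⟩
    (toℕ t′ + i′ * 3) % 3  ≡⟨ [m+kn]%n≡m%n (toℕ t′) i′ 3 ⟩
    toℕ t′ % 3             ≡⟨ m<n⇒m%n≡m (toℕ<n t′) ⟩
    toℕ t′                 ∎)
    where open ≡-Reasoning

  offset-injective : ∀ {t t′ : Fin 3} {i i′} → toℕ t + i * 3 ≡ toℕ t′ + i′ * 3 → t ≡ t′ × i ≡ i′
  offset-injective {t} {t′} {i} {i′} e with offset-remainder {t} {t′} {i} {i′} e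
  ... | refl = refl , *-cancelʳ-≡ i i′ 3 (+-cancelˡ-≡ (toℕ t) _ _ e)

  position-injective : ∀ {a b} → position a ≡ position b → a ≡ b
  position-injective {u j _}   {u .j _}    refl = refl
  position-injective {u j p}   {v _ _ _}   e = contradiction e (m≤n⇒m≢1+n+o _ (≤-recompute p))
  position-injective {v _ _ _} {u j p}     e = contradiction (sym e) (m≤n⇒m≢1+n+o _ (≤-recompute p))
  position-injective {v i _ t} {v i′ _ t′} e
    with offset-injective {t} {t′} {i} {i′} (+-cancelˡ-≡ (suc (suc q)) _ _ e)
  ... | refl , refl = refl

  position-bound : ∀ a → position a < 4 * q + 2
  position-bound (u j p) =
    ≤-trans (s≤s (≤-recompute p)) (subst (suc (suc q) ≤_) vertex-count (m≤m+n _ _))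
  position-bound (v i p t) =
    subst (position (v i p t) <_) vertex-count
          (+-monoʳ-< (suc (suc q)) (offset-bound t (≤-recompute p)))

  vertexAt : ∀ m → m < 4 * q + 2 → Σ[ a ∈ Vertex ] position a ≡ m
  vertexAt m m<N with m ≤? suc q
  ... | yes m≤ = u m m≤ , refl
  ... | no m≰ = v quotient quotient<q remainder , (begin
      suc (suc q) + (toℕ remainder + quotient * 3) ≡⟨ cong (suc (suc q) +_) property ⟨
      suc (suc q) + d                              ≡⟨ m+[n∸m]≡n (≰⇒> m≰) ⟩
      m                                            ∎)
    where
    open ≡-Reasoning
    d = m ∸ suc (suc q)
    open DivMod (d divMod 3)
    quotient<q : quotient < q
    quotient<q = m<n*o⇒m/o<n (+-cancelˡ-< (suc (suc q)) d (q * 3)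
      (subst₂ _<_ (sym (m+[n∸m]≡n (≰⇒> m≰))) (sym vertex-count) m<N))

  toFin : Vertex → Fin (4 * q + 2)
  toFin a = fromℕ< (position-bound a)

  vertexOf : Fin (4 * q + 2) → Vertex
  vertexOf x = proj₁ (vertexAt (toℕ x) (toℕ<n x))

  position-vertexOf : ∀ x → position (vertexOf x) ≡ toℕ x
  position-vertexOf x = proj₂ (vertexAt (toℕ x) (toℕ<n x))

  vertexOf-toFin : ∀ a → vertexOf (toFin a) ≡ a
  vertexOf-toFin a =
    position-injective (trans (position-vertexOf (toFin a)) (toℕ-fromℕ< (position-bound a)))

  toFin-vertexOf : ∀ x → toFin (vertexOf x) ≡ x
  toFin-vertexOf x = toℕ-injective (trans (toℕ-fromℕ< _) (position-vertexOf x))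

  vertexOf-injective : ∀ {x y} → vertexOf x ≡ vertexOf y → x ≡ y
  vertexOf-injective {x} {y} e =
    trans (sym (toFin-vertexOf x)) (trans (cong toFin e) (toFin-vertexOf y))

  -- The edges of \overline{D_q}, oriented as in Arc: the perfect matching M (Matched) and the
  -- rest, which forms the path u_0 ... u_{q+1} and the triangles v_{i1} v_{i2} v_{i3}.
  data Rest : Vertex → Vertex → Set where
    path : ∀ {j} .{p p′} → Rest (u j p) (u (suc j) p′)
    v₁v₂ : ∀ {i} .{p p′} → Rest (v i p first) (v i p′ second)
    v₂v₃ : ∀ {i} .{p p′} → Rest (v i p second) (v i p′ third)
    v₁v₃ : ∀ {i} .{p p′} → Rest (v i p first) (v i p′ third)

  data Matched : Vertex → Vertex → Set where
    u-v₂  : ∀ {i} .{p p′} → Matched (u (suc i) p) (v i p′ second)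
    u-v₁  : ∀ .{p p′} → Matched (u (suc q) p) (v 0 p′ first)
    v₃-v₁ : ∀ {i} .{p p′} → Matched (v i p third) (v (suc i) p′ first)
    v₃-u  : ∀ .{p p′} → Matched (v (suc r) p third) (u 0 p′)

  Edge : Vertex → Vertex → Set
  Edge a b = Rest a b ⊎ Matched a b

  Edge⁺ : Vertex → Vertex → Set
  Edge⁺ a b = Edge a b ⊎ Edge b a

  last-position : ∀ .{p} → 4 * q + 1 ≡ position (v (suc r) p third)
  last-position = identity r
    where
    identity : ∀ r → 4 * suc (suc r) + 1 ≡ suc (suc (suc (suc r))) + (2 + suc r * 3)
    identity = solve-∀

  spoke-position : ∀ i → q + 3 * suc i ≡ suc (suc q) + (1 + i * 3)
  spoke-position i = identity q i
    where
    identity : ∀ m i → m + 3 * suc i ≡ suc (suc m) + (1 + i * 3)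
    identity = solve-∀

  chord-positions : ∀ i → q + 3 * suc i ∸ 1 ≡ suc (suc q) + (0 + i * 3)
                        × q + 3 * suc i + 1 ≡ suc (suc q) + (2 + i * 3)
  chord-positions i = cong (_∸ 1) (identity₁ q i) , identity₂ q i
    where
    identity₁ : ∀ m i → m + 3 * suc i ≡ suc (suc (suc m) + (0 + i * 3))
    identity₁ = solve-∀
    identity₂ : ∀ m i → m + 3 * suc i + 1 ≡ suc (suc m) + (2 + i * 3)
    identity₂ = solve-∀

  consecutive : ∀ a b → position b ≡ suc (position a) → Arc q (position a) (position b)
  consecutive a b e = subst (Arc q _) (sym e) (cyc (subst (_< 4 * q + 2) e (position-bound b)))

  edge→arc : ∀ {a b} → Edge a b → Arc q (position a) (position b)
  edge→arc {a} {b} (inj₁ path)       = consecutive a b refl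
  edge→arc {a} {b} (inj₁ (v₁v₂ {i})) = consecutive a b (+-suc (suc (suc q)) (i * 3))
  edge→arc {a} {b} (inj₁ (v₂v₃ {i})) = consecutive a b (+-suc (suc (suc q)) (suc (i * 3)))
  edge→arc (inj₁ (v₁v₃ {i} {p})) =
    subst₂ (Arc q) (proj₁ (chord-positions i)) (proj₂ (chord-positions i))
           (chord (s≤s z≤n) (≤-recompute p))
  edge→arc (inj₂ (u-v₂ {i} {p′ = p′})) =
    subst (Arc q (suc i)) (spoke-position i) (spoke (s≤s z≤n) (≤-recompute p′))
  edge→arc {a} {b} (inj₂ u-v₁)        = consecutive a b (+-identityʳ (suc (suc q)))
  edge→arc {a} {b} (inj₂ (v₃-v₁ {i})) = consecutive a b (+-suc (suc (suc q)) (suc (suc (i * 3))))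
  edge→arc (inj₂ (v₃-u {p}))          = subst (λ m → Arc q m 0) (last-position {p}) cyc-close

  successor : ∀ a → suc (position a) < 4 * q + 2 →
              Σ[ b ∈ Vertex ] Edge a b × position b ≡ suc (position a)
  successor (u j p) _ with j ≟ suc q
  ... | yes refl = v 0 z<s first , inj₂ u-v₁ , +-identityʳ (suc (suc q))
  ... | no j≢1+q = u (suc j) (≤∧≢⇒< p j≢1+q) , inj₁ path , refl
  successor (v i p first) _  = v i p second , inj₁ v₁v₂ , +-suc (suc (suc q)) (i * 3)
  successor (v i p second) _ = v i p third , inj₁ v₂v₃ , +-suc (suc (suc q)) (suc (i * 3))
  successor (v i p third) bound with i ≟ suc r
  ... | yes refl =
    contradiction bound (<-irrefl (trans (cong suc (sym (last-position {p}))) (sym (+-suc (4 * q) 1))))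
  ... | no i≢1+r =
    v (suc i) (s≤s (≤∧≢⇒< (s≤s⁻¹ p) i≢1+r)) first , inj₂ v₃-v₁ ,
    +-suc (suc (suc q)) (suc (suc (i * 3)))

  edge-at : ∀ {a b a₀ b₀} → Edge a₀ b₀ → position a ≡ position a₀ → position b ≡ position b₀ →
            Edge a b
  edge-at e pa pb = subst₂ Edge (sym (position-injective pa)) (sym (position-injective pb)) e

  arc→edge : ∀ {m n a b} → Arc q m n → position a ≡ m → position b ≡ n → Edge a b
  arc→edge {a = a} {b} (cyc m<) refl pb with successor a m<
  ... | b₀ , e , pb₀ = edge-at e refl (trans pb (sym pb₀))
  arc→edge cyc-close pa pb = edge-at (inj₂ (v₃-u {≤-refl} {z≤n})) (trans pa (last-position {≤-refl})) pb
  arc→edge (spoke {suc i} (s≤s z≤n) i<q) pa pb =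
    edge-at (inj₂ (u-v₂ {p = m≤n⇒m≤1+n i<q} {i<q})) pa (trans pb (spoke-position i))
  arc→edge (chord {suc i} (s≤s z≤n) i<q) pa pb =
    edge-at (inj₁ (v₁v₃ {p = i<q} {i<q}))
            (trans pa (proj₁ (chord-positions i))) (trans pb (proj₂ (chord-positions i)))

  bar→edge : ∀ {x y} → DqBar q x y → Edge⁺ (vertexOf x) (vertexOf y)
  bar→edge {x} {y} = Sum.map (λ arc → arc→edge arc (position-vertexOf x) (position-vertexOf y))
                             (λ arc → arc→edge arc (position-vertexOf y) (position-vertexOf x))

  edge→bar : ∀ {x y} → Edge⁺ (vertexOf x) (vertexOf y) → DqBar q x y
  edge→bar {x} {y} = Sum.map (subst₂ (Arc q) (position-vertexOf x) (position-vertexOf y) ∘ edge→arc)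
                             (subst₂ (Arc q) (position-vertexOf y) (position-vertexOf x) ∘ edge→arc)

  -- The perfect matching M and its colour classes

  -- classU j is the edge of M at u_j, and classV i is v_{i+1,3} v_{i+2,1}.
  data Class : Set where
    classU : (j : ℕ) → .(j ≤ suc q) → Class
    classV : (i : ℕ) → .(i ≤ r) → Class

  data Side : Set where
    left right : Side

  other : Side → Side
  other left  = right
  other right = left

  other-involutive : ∀ s → other (other s) ≡ s
  other-involutive left  = refl
  other-involutive right = refl

  same-or-other : ∀ s s′ → s′ ≡ s ⊎ s′ ≡ other s
  same-or-other left  left  = inj₁ refl
  same-or-other left  right = inj₂ refl
  same-or-other right left  = inj₂ refl
  same-or-other right right = inj₁ refl

  u-mate : ∀ j → .(j ≤ q) → Dec (j ≡ q) → Vertex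
  u-mate j _ (yes _)  = v 0 z<s first
  u-mate j p (no j≢q) = v j (≤∧≢⇒< p j≢q) second

  member : Class → Side → Vertex
  member (classU j p) left        = u j p
  member (classU zero _) right    = v (suc r) ≤-refl third
  member (classU (suc j) p) right = u-mate j (s≤s⁻¹ p) (j ≟ q)
  member (classV i p) left        = v i (s≤s (m≤n⇒m≤1+n p)) third
  member (classV i p) right       = v (suc i) (s≤s (s≤s p)) first

  locate-v₃ : ∀ i → .(i < q) → Dec (i ≡ suc r) → Class × Side
  locate-v₃ i _ (yes _)    = classU 0 z≤n , right
  locate-v₃ i p (no i≢1+r) = classV i (s≤s⁻¹ (≤∧≢⇒< (s≤s⁻¹ p) i≢1+r)) , left

  locate : Vertex → Class × Side
  locate (u j p)             = classU j p , left
  locate (v i p second)      = classU (suc i) (m≤n⇒m≤1+n p) , right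
  locate (v i p third)       = locate-v₃ i p (i ≟ suc r)
  locate (v zero _ first)    = classU (suc q) ≤-refl , right
  locate (v (suc i) p first) = classV i (s≤s⁻¹ (s≤s⁻¹ p)) , right

  classOf : Vertex → Class
  classOf = proj₁ ∘ locate

  sideOf : Vertex → Side
  sideOf = proj₂ ∘ locate

  member-locate : ∀ a → member (classOf a) (sideOf a) ≡ a
  member-locate (u j p) = refl
  member-locate (v zero p first) = by-decision (q ≟ q)
    where
    by-decision : (d : Dec (q ≡ q)) → u-mate q ≤-refl d ≡ v 0 p first
    by-decision (yes _)  = refl
    by-decision (no q≢q) = contradiction refl q≢q
  member-locate (v (suc i) p first) = refl
  member-locate (v i p second) = by-decision (i ≟ q)
    where
    by-decision : (d : Dec (i ≡ q)) → u-mate i (<⇒≤ p) d ≡ v i p second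
    by-decision (yes refl) = contradiction (≤-recompute p) (<-irrefl refl)
    by-decision (no _)     = refl
  member-locate (v i p third) = by-decision (i ≟ suc r)
    where
    by-decision : (d : Dec (i ≡ suc r)) →
                  member (proj₁ (locate-v₃ i p d)) (proj₂ (locate-v₃ i p d)) ≡ v i p third
    by-decision (yes refl) = refl
    by-decision (no _)     = refl

  locate-last : ∀ .{p} → locate (v (suc r) p third) ≡ (classU 0 z≤n , right)
  locate-last = by-decision (suc r ≟ suc r)
    where
    by-decision : ∀ .{p} (d : Dec (suc r ≡ suc r)) → locate-v₃ (suc r) p d ≡ (classU 0 z≤n , right)
    by-decision (yes _)  = refl
    by-decision (no r≢r) = contradiction refl r≢r

  locate-inner-v₃ : ∀ {i} .{p} (i≤r : i ≤ r) → locate (v i p third) ≡ (classV i i≤r , left)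
  locate-inner-v₃ {i} i≤r = by-decision (i ≟ suc r)
    where
    by-decision : ∀ .{p} (d : Dec (i ≡ suc r)) → locate-v₃ i p d ≡ (classV i i≤r , left)
    by-decision (yes refl) = contradiction i≤r 1+n≰n
    by-decision (no _)     = refl

  locate-member : ∀ κ s → locate (member κ s) ≡ (κ , s)
  locate-member (classU j p) left        = refl
  locate-member (classU zero p) right    = locate-last
  locate-member (classU (suc j) p) right = by-decision (j ≟ q)
    where
    by-decision : (d : Dec (j ≡ q)) → locate (u-mate j (s≤s⁻¹ p) d) ≡ (classU (suc j) p , right)
    by-decision (yes refl) = refl
    by-decision (no _)     = refl
  locate-member (classV i p) left        = locate-inner-v₃ (≤-recompute p)
  locate-member (classV i p) right       = refl

  classOf-member : ∀ κ s → classOf (member κ s) ≡ κ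
  classOf-member κ s = cong proj₁ (locate-member κ s)

  sideOf-member : ∀ κ s → sideOf (member κ s) ≡ s
  sideOf-member κ s = cong proj₂ (locate-member κ s)

  partner : Vertex → Vertex
  partner a = member (classOf a) (other (sideOf a))

  partner-class : ∀ a → classOf (partner a) ≡ classOf a
  partner-class a = classOf-member _ _

  partner-involutive : ∀ a → partner (partner a) ≡ a
  partner-involutive a = begin
    member (classOf (partner a)) (other (sideOf (partner a)))
      ≡⟨ cong₂ (λ κ s → member κ (other s)) (partner-class a) (sideOf-member (classOf a) _) ⟩
    member (classOf a) (other (other (sideOf a)))
      ≡⟨ cong (member (classOf a)) (other-involutive (sideOf a)) ⟩
    member (classOf a) (sideOf a)
      ≡⟨ member-locate a ⟩
    a ∎
    where open ≡-Reasoning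

  same-class : ∀ {a b} → classOf a ≡ classOf b → b ≡ a ⊎ b ≡ partner a
  same-class {a} {b} e with same-or-other (sideOf a) (sideOf b)
  ... | inj₁ same =
    inj₁ (trans (sym (member-locate b)) (trans (cong₂ member (sym e) same) (member-locate a)))
  ... | inj₂ opposite = inj₂ (trans (sym (member-locate b)) (cong₂ member (sym e) opposite))

  Matched⁺ : Vertex → Vertex → Set
  Matched⁺ a b = Matched a b ⊎ Matched b a

  members-matched : ∀ κ → Matched⁺ (member κ left) (member κ right)
  members-matched (classU zero p)    = inj₂ v₃-u
  members-matched (classU (suc j) p) = by-decision (j ≟ q)
    where
    by-decision : (d : Dec (j ≡ q)) → Matched⁺ (u (suc j) p) (u-mate j (s≤s⁻¹ p) d)
    by-decision (yes refl) = inj₁ u-v₁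
    by-decision (no _)     = inj₁ u-v₂
  members-matched (classV i p)       = inj₁ v₃-v₁

  partner-matched : ∀ a → Matched⁺ a (partner a)
  partner-matched a =
    subst (λ b → Matched⁺ b (partner a)) (member-locate a) (matched (classOf a) (sideOf a))
    where
    matched : ∀ κ s → Matched⁺ (member κ s) (member κ (other s))
    matched κ left  = members-matched κ
    matched κ right = Sum.swap (members-matched κ)

  matched-class : ∀ {a b} → Matched a b → classOf a ≡ classOf b
  matched-class u-v₂              = refl
  matched-class u-v₁              = refl
  matched-class (v₃-v₁ {p′ = p′}) = cong proj₁ (locate-inner-v₃ (s≤s⁻¹ (s≤s⁻¹ (≤-recompute p′))))
  matched-class v₃-u              = cong proj₁ locate-last

  -- Two edges of M are joined by at most one edge of \overline{D_q}

  Rest⁺ : Vertex → Vertex → Set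
  Rest⁺ a b = Rest a b ⊎ Rest b a

  -- Rest edges stay inside the path or a triangle, edges of M leave it.
  component : Vertex → ℕ
  component (u _ _)   = 0
  component (v i _ _) = suc i

  rest-component : ∀ {a b} → Rest a b → component a ≡ component b
  rest-component path = refl
  rest-component v₁v₂ = refl
  rest-component v₂v₃ = refl
  rest-component v₁v₃ = refl

  rest-component⁺ : ∀ {a b} → Rest⁺ a b → component a ≡ component b
  rest-component⁺ (inj₁ rest) = rest-component rest
  rest-component⁺ (inj₂ rest) = sym (rest-component rest)

  matched-component : ∀ {a b} → Matched a b → component a ≢ component b
  matched-component u-v₂  ()
  matched-component u-v₁  ()
  matched-component v₃-v₁ ()
  matched-component v₃-u  ()

  partner-component : ∀ a → component (partner a) ≢ component a
  partner-component a e with partner-matched a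
  ... | inj₁ matched = matched-component matched (sym e)
  ... | inj₂ matched = matched-component matched e

  -- This fails for q = 1, where the edges u_1 v_{12}, u_2 v_{11} of M together
  -- with u_1 u_2 and v_{11} v_{12} would form such a square.
  no-alternating-square : ∀ {x y x′ y′} → Rest x y → Matched⁺ x x′ → Matched⁺ y y′ → ¬ Rest⁺ x′ y′
  no-alternating-square path (inj₁ u-v₂)  (inj₁ u-v₂)  = λ { (inj₁ ()) ; (inj₂ ()) }
  no-alternating-square path (inj₁ u-v₂)  (inj₁ u-v₁)  = λ { (inj₁ ()) ; (inj₂ ()) }
  no-alternating-square path (inj₁ u-v₁)  (inj₁ u-v₂)  = λ { (inj₁ ()) ; (inj₂ ()) }
  no-alternating-square path (inj₂ v₃-u)  (inj₁ u-v₂)  = λ { (inj₁ ()) ; (inj₂ ()) }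
  no-alternating-square v₁v₂ (inj₂ u-v₁)  (inj₂ u-v₂)  = λ { (inj₁ ()) ; (inj₂ ()) }
  no-alternating-square v₁v₂ (inj₂ v₃-v₁) (inj₂ u-v₂)  = λ { (inj₁ ()) ; (inj₂ ()) }
  no-alternating-square v₂v₃ (inj₂ u-v₂)  (inj₁ v₃-v₁) = λ { (inj₁ ()) ; (inj₂ ()) }
  no-alternating-square v₂v₃ (inj₂ u-v₂)  (inj₁ v₃-u)  = λ { (inj₁ ()) ; (inj₂ ()) }
  no-alternating-square v₁v₃ (inj₂ u-v₁)  (inj₁ v₃-v₁) = λ { (inj₁ ()) ; (inj₂ ()) }
  no-alternating-square v₁v₃ (inj₂ v₃-v₁) (inj₁ v₃-v₁) = λ { (inj₁ ()) ; (inj₂ ()) }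
  no-alternating-square v₁v₃ (inj₂ v₃-v₁) (inj₁ v₃-u)  = λ { (inj₁ ()) ; (inj₂ ()) }

  no-alternating-square⁺ : ∀ {x y x′ y′} → Rest⁺ x y → Matched⁺ x x′ → Matched⁺ y y′ →
                           ¬ Rest⁺ x′ y′
  no-alternating-square⁺ (inj₁ rest) m m′ = no-alternating-square rest m m′
  no-alternating-square⁺ (inj₂ rest) m m′ = no-alternating-square rest m′ m ∘ Sum.swap

  cross-class-rest : ∀ {a b} → classOf a ≢ classOf b → Edge⁺ a b → Rest⁺ a b
  cross-class-rest _     (inj₁ (inj₁ rest))    = inj₁ rest
  cross-class-rest _     (inj₂ (inj₁ rest))    = inj₂ rest
  cross-class-rest κa≢κb (inj₁ (inj₂ matched)) = contradiction (matched-class matched) κa≢κb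
  cross-class-rest κa≢κb (inj₂ (inj₂ matched)) = contradiction (sym (matched-class matched)) κa≢κb

  separated-classes : ∀ {a b} → classOf a ≢ classOf b → Edge⁺ a b →
                      ¬ Edge⁺ a (partner b) × ¬ Edge⁺ (partner a) b × ¬ Edge⁺ (partner a) (partner b)
  separated-classes {a} {b} κa≢κb ab = ab′ , a′b , a′b′
    where
    κa≢κb′ : classOf a ≢ classOf (partner b)
    κa≢κb′ e = κa≢κb (trans e (partner-class b))
    κa′≢κb : classOf (partner a) ≢ classOf b
    κa′≢κb e = κa≢κb (trans (sym (partner-class a)) e)
    κa′≢κb′ : classOf (partner a) ≢ classOf (partner b)
    κa′≢κb′ e = κa≢κb′ (trans (sym (partner-class a)) e)

    rest-ab : Rest⁺ a b
    rest-ab = cross-class-rest κa≢κb ab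

    ab′ : ¬ Edge⁺ a (partner b)
    ab′ e = partner-component b
      (trans (sym (rest-component⁺ (cross-class-rest κa≢κb′ e))) (rest-component⁺ rest-ab))
    a′b : ¬ Edge⁺ (partner a) b
    a′b e = partner-component a
      (trans (rest-component⁺ (cross-class-rest κa′≢κb e)) (sym (rest-component⁺ rest-ab)))
    a′b′ : ¬ Edge⁺ (partner a) (partner b)
    a′b′ e = no-alternating-square⁺ rest-ab (partner-matched a) (partner-matched b)
               (cross-class-rest κa′≢κb′ e)

  -- The two colourings

  classIndex : Class → ℕ
  classIndex (classU j _) = j
  classIndex (classV i _) = suc (suc q) + i

  colour-count : suc (suc (suc q) + r) ≡ 2 * q + 1
  colour-count = identity r
    where
    identity : ∀ r → suc (suc (suc (suc (suc r))) + r) ≡ 2 * suc (suc r) + 1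
    identity = solve-∀

  classIndex-bound : ∀ κ → classIndex κ < 2 * q + 1
  classIndex-bound (classU j p) =
    subst (suc j ≤_) colour-count (s≤s (≤-trans (≤-recompute p) (m≤n⇒m≤1+n (m≤m+n (suc q) r))))
  classIndex-bound (classV i p) =
    subst (suc (classIndex (classV i p)) ≤_) colour-count
          (s≤s (+-monoʳ-≤ (suc (suc q)) (≤-recompute p)))

  classIndex-injective : ∀ {κ κ′} → classIndex κ ≡ classIndex κ′ → κ ≡ κ′
  classIndex-injective {classU j _} {classU .j _} refl = refl
  classIndex-injective {classU j p} {classV i _}  e = contradiction e (m≤n⇒m≢1+n+o i (≤-recompute p))
  classIndex-injective {classV i _} {classU j p}  e =
    contradiction (sym e) (m≤n⇒m≢1+n+o i (≤-recompute p))
  classIndex-injective {classV i _} {classV i′ _} e with +-cancelˡ-≡ (suc (suc q)) i i′ e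
  ... | refl = refl

  classAt : ∀ α → α < 2 * q + 1 → Σ[ κ ∈ Class ] classIndex κ ≡ α
  classAt α α< with α ≤? suc q
  ... | yes α≤ = classU α α≤ , refl
  ... | no α≰ =
    classV (α ∸ suc (suc q)) (+-cancelˡ-≤ (suc (suc q)) _ _ offset≤) , m+[n∸m]≡n (≰⇒> α≰)
    where
    offset≤ : suc (suc q) + (α ∸ suc (suc q)) ≤ suc (suc q) + r
    offset≤ = subst₂ _≤_ (sym (m+[n∸m]≡n (≰⇒> α≰))) refl
                     (s≤s⁻¹ (subst (suc α ≤_) (sym colour-count) α<))

  classColour : Class → Fin (2 * q + 1)
  classColour κ = fromℕ< (classIndex-bound κ)

  toℕ-classColour : ∀ κ → toℕ (classColour κ) ≡ classIndex κ
  toℕ-classColour κ = toℕ-fromℕ< (classIndex-bound κ)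

  colouring : Assignment (4 * q + 2) (2 * q + 1)
  colouring = classColour ∘ classOf ∘ vertexOf

  finPartner : Fin (4 * q + 2) → Fin (4 * q + 2)
  finPartner = toFin ∘ partner ∘ vertexOf

  vertexOf-finPartner : ∀ x → vertexOf (finPartner x) ≡ partner (vertexOf x)
  vertexOf-finPartner x = vertexOf-toFin _

  colouring-class : ∀ {x y} → colouring x ≡ colouring y → classOf (vertexOf x) ≡ classOf (vertexOf y)
  colouring-class {x} {y} e = classIndex-injective
    (trans (sym (toℕ-classColour (classOf (vertexOf x))))
           (trans (cong toℕ e) (toℕ-classColour (classOf (vertexOf y)))))

  colouring-partner : ∀ x → colouring (finPartner x) ≡ colouring x
  colouring-partner x =
    cong classColour (trans (cong classOf (vertexOf-finPartner x)) (partner-class (vertexOf x)))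

  finPartner-involutive : ∀ x → finPartner (finPartner x) ≡ x
  finPartner-involutive x = begin
    toFin (partner (vertexOf (finPartner x))) ≡⟨ cong (toFin ∘ partner) (vertexOf-finPartner x) ⟩
    toFin (partner (partner (vertexOf x)))    ≡⟨ cong toFin (partner-involutive (vertexOf x)) ⟩
    toFin (vertexOf x)                        ≡⟨ toFin-vertexOf x ⟩
    x                                         ∎
    where open ≡-Reasoning

  colouring-classes : ∀ {x y} → colouring x ≡ colouring y → y ≡ x ⊎ y ≡ finPartner x
  colouring-classes {x} {y} e =
    Sum.map vertexOf-injective (λ e′ → trans (sym (toFin-vertexOf y)) (cong toFin e′))
            (same-class {vertexOf x} {vertexOf y} (colouring-class {x} {y} e))

  colouring-surjective : ∀ α → Σ[ x ∈ Fin (4 * q + 2) ] colouring x ≡ α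
  colouring-surjective α = toFin (member κ left) , toℕ-injective (begin
    toℕ (colouring (toFin (member κ left)))
      ≡⟨ toℕ-classColour (classOf (vertexOf (toFin (member κ left)))) ⟩
    classIndex (classOf (vertexOf (toFin (member κ left))))
      ≡⟨ cong (classIndex ∘ classOf) (vertexOf-toFin (member κ left)) ⟩
    classIndex (classOf (member κ left))
      ≡⟨ cong classIndex (classOf-member κ left) ⟩
    classIndex κ
      ≡⟨ proj₂ (classAt (toℕ α) (toℕ<n α)) ⟩
    toℕ α ∎)
    where
    open ≡-Reasoning
    κ = proj₁ (classAt (toℕ α) (toℕ<n α))

  colouring-proper : IsColouring (Dq q) (2 * q + 1) colouring
  colouring-proper x y (x≢y , ¬bar) e with colouring-classes e
  ... | inj₁ y≡x  = x≢y (sym y≡x)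
  ... | inj₂ y≡x′ = ¬bar (edge→bar
    (subst (Edge⁺ (vertexOf x)) (sym (trans (cong vertexOf y≡x′) (vertexOf-finPartner x)))
           (Sum.map inj₂ inj₂ (partner-matched (vertexOf x)))))

  Dq-sym : ∀ {x y} → Dq q x y → Dq q y x
  Dq-sym (x≢y , ¬bar) = x≢y ∘ sym , ¬bar ∘ Sum.swap

  colouring-linked : ∀ {x y} → colouring x ≢ colouring y →
                     Dq q x y ⊎ (Dq q x (finPartner y) × Dq q (finPartner x) y ×
                                 Dq q (finPartner x) (finPartner y))
  colouring-linked {x} {y} cx≢cy with arc? q (toℕ x) (toℕ y) ⊎-dec arc? q (toℕ y) (toℕ x)
  ... | no ¬bar = inj₁ (cx≢cy ∘ cong colouring , ¬bar)
  ... | yes bar = inj₂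
    ( (distinct (λ e → cx≢cy (trans e (colouring-partner y))) ,
       ab′ ∘ between refl (vertexOf-finPartner y))
    , (distinct (λ e → cx≢cy (trans (sym (colouring-partner x)) e)) ,
       a′b ∘ between (vertexOf-finPartner x) refl)
    , (distinct (λ e → cx≢cy (trans (sym (colouring-partner x)) (trans e (colouring-partner y)))) ,
       a′b′ ∘ between (vertexOf-finPartner x) (vertexOf-finPartner y)) )
    where
    distinct : ∀ {x y} → colouring x ≢ colouring y → x ≢ y
    distinct c≢ = c≢ ∘ cong colouring
    between : ∀ {x′ y′ a b} → vertexOf x′ ≡ a → vertexOf y′ ≡ b → DqBar q x′ y′ → Edge⁺ a b
    between refl refl = bar→edge
    separated = separated-classes (cx≢cy ∘ cong classColour) (bar→edge bar)
    ab′ = proj₁ separated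
    a′b = proj₁ (proj₂ separated)
    a′b′ = proj₂ (proj₂ separated)

  twice-colour-count : 4 * q + 2 ≡ (2 * q + 1) + (2 * q + 1)
  twice-colour-count = identity q
    where
    identity : ∀ m → 4 * m + 2 ≡ (2 * m + 1) + (2 * m + 1)
    identity = solve-∀

  halving : Assignment (4 * q + 2) (2 * q + 1)
  halving x = fromℕ< (m<n+n⇒⌊m/2⌋<n (subst (toℕ x <_) twice-colour-count (toℕ<n x)))

  halving-proper : IsColouring (Dq q) (2 * q + 1) halving
  halving-proper x y (x≢y , ¬bar) e
    with ⌊m/2⌋≡⌊n/2⌋⇒m≡n⊎adjacent (toℕ x) (toℕ y)
           (trans (sym (toℕ-fromℕ< _)) (trans (cong toℕ e) (toℕ-fromℕ< _)))
  ... | inj₁ same         = x≢y (toℕ-injective same)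
  ... | inj₂ (inj₁ y≡1+x) =
    ¬bar (inj₁ (subst (Arc q (toℕ x)) (sym y≡1+x) (cyc (subst (_< _) y≡1+x (toℕ<n y)))))
  ... | inj₂ (inj₂ x≡1+y) =
    ¬bar (inj₂ (subst (Arc q (toℕ y)) (sym x≡1+y) (cyc (subst (_< _) x≡1+y (toℕ<n x)))))

  ¬kempeClass-Dq : ¬ IsKempeClass (Dq q) (2 * q + 1)
  ¬kempeClass-Dq = ¬kempeClass colouring-proper {x = zero} {y = suc zero} halving-proper refl λ ()
    where
    open PairColouring (Dq q) Dq-sym colouring colouring-surjective finPartner colouring-partner
                       finPartner-involutive colouring-classes colouring-linked

lemma7 : (q : ℕ) → 2 ≤ q → ¬ IsKempeClass (Dq q) (2 * q + 1)
lemma7 (suc (suc r)) (s≤s (s≤s z≤n)) = D.¬kempeClass-Dq r
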